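{- Let $P.\phi$ be a QBF with $\phi$ in CNF, and suppose that $C$ is a clause which can be derived from $\phi$ using the rules S, R, U (together with the axiom rule A). Then $C$ can also be derived using only the rules R, U (together with A).
   Context: A QBF is $P.\phi$ with $\phi$ a CNF (clauses viewed as sets of literals $x$, $\bar x$) and $P=Q_1x_1\cdots Q_nx_n$ with $Q_i\in\{\forall,\exists\}$; $x_i<_P x_j$ iff $i<j$. Rules: (A) any clause of $\phi$ may be derived; (R) from derived clauses $C\lor x$ and $C'\lor\bar x$, with $x$ existential and $C\cup C'$ not a tautology, derive $C\lor C'$; (U) from a derived clause $C\lor l$ with $l$ a universal literal, $\bar l\notin C$, and every existential literal $k\in C$ satisfying $k<_P l$, derive $C$; (S) from a derived clause $C$ and a symmetry $\sigma$ of $P.\phi$, derive $\sigma(C)$ (the clause obtained by applying $\sigma$ to each literal). A bijection $\sigma$ of the literal set $\{x_1,\dots,x_n,\bar x_1,\dots,\bar x_n\}$ is admissible for $P$ if $\overline{\sigma(x)}=\sigma(\bar x)$ for every variable $x$, and $\sigma(x_i)\in\{x_j,\bar x_j\}$ only if $Q_{\min(i,j)}=\cdots=Q_{\max(i,j)}$ (same quantifier block). An admissible $\sigma$ is a symmetry of $P.\phi$ if applying $\sigma$ to all literals of $\phi$ maps $\phi$ to itself up to reordering clauses and literals. -}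

module Defs where

open import Data.Nat using (ℕ; _≤_; _<_)
open import Data.Fin using (Fin; toℕ)
open import Data.Bool using (Bool; true; false)
open import Data.List using (List; map)
open import Data.List.Membership.Propositional using (_∈_)
open import Data.Product using (_×_; Σ; ∃; _,_)
open import Data.Sum using (_⊎_)
open import Relation.Binary.PropositionalEquality using (_≡_; _≢_)
open import Relation.Nullary using (¬_)
open import Function.Bundles using (_↔_; Inverse)

-- Quantifiers and prefixes: P = Q_1 x_1 ... Q_n x_n, variables are Fin n,
-- the prefix order x_i <_P x_j is  toℕ i < toℕ j.
data Quant : Set where
  ∀q ∃q : Quant

Prefix : ℕ → Set
Prefix n = Fin n → Quant

data Lit (n : ℕ) : Set where
  pos : Fin n → Lit n
  neg : Fin n → Lit n

var : ∀ {n} → Lit n → Fin n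
var (pos x) = x
var (neg x) = x

compl : ∀ {n} → Lit n → Lit n
compl (pos x) = neg x
compl (neg x) = pos x

IsExists : ∀ {n} → Prefix n → Lit n → Set
IsExists P l = P (var l) ≡ ∃q

IsUniv : ∀ {n} → Prefix n → Lit n → Set
IsUniv P l = P (var l) ≡ ∀q

_<[_]_ : ∀ {n} → Lit n → Prefix n → Lit n → Set
k <[ P ] l = toℕ (var k) < toℕ (var l)

-- Clauses are sets of literals, represented by lists and compared as sets.
Clause : ℕ → Set
Clause n = List (Lit n)

CNF : ℕ → Set
CNF n = List (Clause n)

_≈_ : ∀ {n} → Clause n → Clause n → Set
C ≈ D = ∀ l → (l ∈ C → l ∈ D) × (l ∈ D → l ∈ C)

Tautology : ∀ {n} → Clause n → Set
Tautology C = ∃ λ x → (pos x ∈ C) × (neg x ∈ C)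

Between : ∀ {n} → Fin n → Fin n → Fin n → Set
Between i j k = (toℕ i ≤ toℕ k × toℕ k ≤ toℕ j) ⊎ (toℕ j ≤ toℕ k × toℕ k ≤ toℕ i)

record Admissible {n} (P : Prefix n) (σ : Lit n ↔ Lit n) : Set where
  private f = Inverse.to σ
  field
    respects-compl : ∀ l → f (compl l) ≡ compl (f l)
    same-block : ∀ i k → Between i (var (f (pos i))) k → P k ≡ P i

applyσ : ∀ {n} → (Lit n ↔ Lit n) → Clause n → Clause n
applyσ σ C = map (Inverse.to σ) C

-- σ maps φ to itself up to reordering clauses and literals
-- (φ viewed as a set of clauses, clauses as sets of literals)
record Symmetry {n} (P : Prefix n) (φ : CNF n) (σ : Lit n ↔ Lit n) : Set where
  field
    admissible : Admissible P σ
    image⊆ : ∀ C → C ∈ φ → ∃ λ D → D ∈ φ × (applyσ σ C ≈ D)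
    ⊆image : ∀ D → D ∈ φ → ∃ λ C → C ∈ φ × (applyσ σ C ≈ D)

-- Derivations; the flag says whether rule S is allowed.
-- Each rule may conclude any clause set-equal to the specified one.
data Derivable {n} (useS : Bool) (P : Prefix n) (φ : CNF n) : Clause n → Set where
  ruleA : ∀ {C E} → C ∈ φ → E ≈ C → Derivable useS P φ E
  ruleR : ∀ {D₁ D₂ E} (x : Fin n) →
          Derivable useS P φ D₁ → Derivable useS P φ D₂ →
          IsExists P (pos x) → pos x ∈ D₁ → neg x ∈ D₂ →
          -- E = (D₁ ∖ {x}) ∪ (D₂ ∖ {x̄})
          (∀ l → (l ∈ E → (l ∈ D₁ × l ≢ pos x) ⊎ (l ∈ D₂ × l ≢ neg x))
               × ((l ∈ D₁ × l ≢ pos x) ⊎ (l ∈ D₂ × l ≢ neg x) → l ∈ E)) →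
          ¬ Tautology E →
          Derivable useS P φ E
  ruleU : ∀ {D E} (l : Lit n) →
          Derivable useS P φ D → IsUniv P l → l ∈ D →
          -- E = D ∖ {l}
          (∀ k → (k ∈ E → k ∈ D × k ≢ l) × (k ∈ D × k ≢ l → k ∈ E)) →
          ¬ (compl l ∈ E) →
          (∀ k → k ∈ E → IsExists P k → k <[ P ] l) →
          Derivable useS P φ E
  ruleS : ∀ {D E} (σ : Lit n ↔ Lit n) → useS ≡ true →
          Derivable useS P φ D → Symmetry P φ σ → E ≈ applyσ σ D →
          Derivable useS P φ E

-- A symmetry preserves quantifier types and, since quantifier blocks are intervals of
-- the prefix, the relative order of literals from different blocks. Hence the image of
-- an instance of R or U is again an instance of the same rule, and rule S can be pushed
-- up to the leaves: by induction on the derivation, the image of a derived clause under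
-- any composite of symmetries is derivable with R and U alone, the axioms being permuted
-- among themselves.
module Submission where

open import Defs
open import Data.Nat using (ℕ; _<_)
open import Data.Nat.Properties using (≤-refl; ≤-total; <⇒≤; ≮⇒≥; _<?_)
open import Data.Bool using (Bool; true; false)
open import Data.Fin using (Fin; toℕ)
open import Data.List using (map)
open import Data.List.Properties using (map-id; map-∘)
open import Data.List.Membership.Propositional using (_∈_)
open import Data.List.Membership.Propositional.Properties using (∈-map⁺; ∈-map⁻)
open import Data.Product using (_×_; ∃; _,_; proj₁; proj₂)
open import Data.Sum as Sum using (_⊎_; inj₁; inj₂)
open import Data.Empty using (⊥-elim)
open import Relation.Nullary using (¬_; yes; no)
open import Relation.Binary.PropositionalEquality
open import Function using (_∘_; id; Injective)
open import Function.Bundles using (_↔_; Inverse; Injection)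
open import Function.Properties.Inverse using (↔⇒↣)

private
  variable
    n : ℕ
    b : Bool
    P : Prefix n
    φ : CNF n
    C D D₁ D₂ E : Clause n
    f g : Lit n → Lit n

≈-refl : C ≈ C
≈-refl l = id , id

≈-trans : C ≈ D → D ≈ E → C ≈ E
≈-trans C≈D D≈E l = proj₁ (D≈E l) ∘ proj₁ (C≈D l) , proj₂ (C≈D l) ∘ proj₂ (D≈E l)

≡⇒≈ : C ≡ D → C ≈ D
≡⇒≈ refl = ≈-refl

map-≈ : (f : Lit n → Lit n) → C ≈ D → map f C ≈ map f D
map-≈ f C≈D l = transfer (proj₁ ∘ C≈D) , transfer (proj₂ ∘ C≈D)
  where
  transfer : ∀ {C D} → (∀ k → k ∈ C → k ∈ D) → l ∈ map f C → l ∈ map f D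
  transfer C⊆D l∈ with ∈-map⁻ f l∈
  ... | k , k∈ , refl = ∈-map⁺ f (C⊆D k k∈)

∈-map⁻-injective : Injective _≡_ _≡_ f → ∀ {l} → f l ∈ map f C → l ∈ C
∈-map⁻-injective {f = f} f-inj fl∈ with ∈-map⁻ f fl∈
... | k , k∈ , fl≡fk = subst (_∈ _) (sym (f-inj fl≡fk)) k∈

var-compl : (l : Lit n) → var (compl l) ≡ var l
var-compl (pos x) = refl
var-compl (neg x) = refl

complementary⇒tautology : ∀ {l} → l ∈ C → compl l ∈ C → Tautology C
complementary⇒tautology {l = pos x} l∈ l̄∈ = x , l∈ , l̄∈
complementary⇒tautology {l = neg x} l∈ l̄∈ = x , l̄∈ , l∈

Resolvent : Clause n → Lit n → Clause n → Lit n → Clause n → Set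
Resolvent D₁ u D₂ v E = ∀ l → (l ∈ E → (l ∈ D₁ × l ≢ u) ⊎ (l ∈ D₂ × l ≢ v))
                            × ((l ∈ D₁ × l ≢ u) ⊎ (l ∈ D₂ × l ≢ v) → l ∈ E)

Reduct : Clause n → Lit n → Clause n → Set
Reduct D u E = ∀ k → (k ∈ E → k ∈ D × k ≢ u) × (k ∈ D × k ≢ u → k ∈ E)

ExistentialsBelow : Prefix n → Clause n → Lit n → Set
ExistentialsBelow P E u = ∀ k → k ∈ E → IsExists P k → k <[ P ] u

resolvent-swap : ∀ {u v} → Resolvent D₁ u D₂ v E → Resolvent D₂ v D₁ u E
resolvent-swap res l = Sum.swap ∘ proj₁ (res l) , proj₂ (res l) ∘ Sum.swap

resolvent-resp-≈ : ∀ {u v} → E ≈ D → Resolvent D₁ u D₂ v D → Resolvent D₁ u D₂ v E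
resolvent-resp-≈ E≈D res l = proj₁ (res l) ∘ proj₁ (E≈D l) , proj₂ (E≈D l) ∘ proj₂ (res l)

reduct-resp-≈ : ∀ {u} → E ≈ D → Reduct C u D → Reduct C u E
reduct-resp-≈ E≈D red k = proj₁ (red k) ∘ proj₁ (E≈D k) , proj₂ (E≈D k) ∘ proj₂ (red k)

tautology-resp-≈ : E ≈ D → Tautology E → Tautology D
tautology-resp-≈ E≈D (x , p∈ , n∈) = x , proj₁ (E≈D _) p∈ , proj₁ (E≈D _) n∈

derivable-resp-≈ : E ≈ D → Derivable b P φ D → Derivable b P φ E
derivable-resp-≈ E≈D (ruleA C∈ D≈C) = ruleA C∈ (≈-trans E≈D D≈C)
derivable-resp-≈ E≈D (ruleR x d₁ d₂ ex p∈ n∈ res nt) =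
  ruleR x d₁ d₂ ex p∈ n∈ (resolvent-resp-≈ E≈D res) (nt ∘ tautology-resp-≈ E≈D)
derivable-resp-≈ E≈D (ruleU l d un l∈ red l̄∉ below) =
  ruleU l d un l∈ (reduct-resp-≈ E≈D red) (l̄∉ ∘ proj₁ (E≈D _)) (λ k → below k ∘ proj₁ (E≈D k))
derivable-resp-≈ E≈D (ruleS σ useS d S D≈σC) = ruleS σ useS d S (≈-trans E≈D D≈σC)

resolve : (u : Lit n) → Derivable b P φ D₁ → Derivable b P φ D₂ → IsExists P u →
          u ∈ D₁ → compl u ∈ D₂ → Resolvent D₁ u D₂ (compl u) E → ¬ Tautology E →
          Derivable b P φ E
resolve (pos x) d₁ d₂ ex u∈ ū∈ res = ruleR x d₁ d₂ ex u∈ ū∈ res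
resolve (neg x) d₁ d₂ ex u∈ ū∈ res = ruleR x d₂ d₁ ex ū∈ u∈ (resolvent-swap res)

WithinBlock : Prefix n → Fin n → Fin n → Set
WithinBlock P i j = ∀ k → Between i j k → P k ≡ P i

withinBlock-end : ∀ {i j} → WithinBlock P i j → P j ≡ P i
withinBlock-end {i = i} {j} W with ≤-total (toℕ i) (toℕ j)
... | inj₁ i≤j = W j (inj₁ (i≤j , ≤-refl))
... | inj₂ j≤i = W j (inj₂ (≤-refl , j≤i))

-- If the images were out of order, either a would lie in the block of b, or
-- the image b′ would lie in the block of a.
withinBlock-order : ∀ {a a′ b b′} → WithinBlock P a a′ → WithinBlock P b b′ →
                    P a ≢ P b → toℕ a < toℕ b → toℕ a′ < toℕ b′
withinBlock-order {a = a} {a′} {b} {b′} Wa Wb Pa≢Pb a<b with toℕ a′ <? toℕ b′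
... | yes a′<b′ = a′<b′
... | no a′≮b′ with ≤-total (toℕ b′) (toℕ a)
...   | inj₁ b′≤a = ⊥-elim (Pa≢Pb (Wb a (inj₂ (b′≤a , <⇒≤ a<b))))
...   | inj₂ a≤b′ =
        ⊥-elim (Pa≢Pb (trans (sym (Wa b′ (inj₁ (a≤b′ , ≮⇒≥ a′≮b′)))) (withinBlock-end Wb)))

admissible⇒withinBlock : ∀ {σ : Lit n ↔ Lit n} → Admissible P σ →
                         ∀ l → WithinBlock P (var l) (var (Inverse.to σ l))
admissible⇒withinBlock adm (pos i) = Admissible.same-block adm i
admissible⇒withinBlock {σ = σ} adm (neg i) k
  rewrite Admissible.respects-compl adm (pos i) | var-compl (Inverse.to σ (pos i)) =
  Admissible.same-block adm i k

-- The consequences of being a symmetry that the rules R, U and A need; unlike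
-- Symmetry itself, this notion is closed under composition without further work.
record QuasiSymmetry (P : Prefix n) (φ : CNF n) (f : Lit n → Lit n) : Set where
  field
    injective            : Injective _≡_ _≡_ f
    compl-commutes       : ∀ l → f (compl l) ≡ compl (f l)
    quant-preserved      : ∀ l → P (var (f l)) ≡ P (var l)
    cross-block-monotone : ∀ k l → P (var k) ≢ P (var l) → k <[ P ] l → f k <[ P ] f l
    maps-φ               : ∀ C → C ∈ φ → ∃ λ D → D ∈ φ × map f C ≈ D

open QuasiSymmetry

quasiSymmetry-id : QuasiSymmetry P φ id
quasiSymmetry-id = record
  { injective            = id
  ; compl-commutes       = λ _ → refl
  ; quant-preserved      = λ _ → refl
  ; cross-block-monotone = λ _ _ _ → id
  ; maps-φ               = λ C C∈ → C , C∈ , ≡⇒≈ (map-id C)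
  }

quasiSymmetry-∘ : QuasiSymmetry P φ f → QuasiSymmetry P φ g → QuasiSymmetry P φ (f ∘ g)
quasiSymmetry-∘ {P = P} {f = f} {g = g} F G = record
  { injective            = injective G ∘ injective F
  ; compl-commutes       = λ l → trans (cong f (compl-commutes G l)) (compl-commutes F (g l))
  ; quant-preserved      = λ l → trans (quant-preserved F (g l)) (quant-preserved G l)
  ; cross-block-monotone = λ k l Pk≢Pl k<l →
      cross-block-monotone F (g k) (g l)
        (λ Pgk≡Pgl → Pk≢Pl (trans (sym (quant-preserved G k)) (trans Pgk≡Pgl (quant-preserved G l))))
        (cross-block-monotone G k l Pk≢Pl k<l)
  ; maps-φ               = maps-φ-∘
  }
  where
  maps-φ-∘ : ∀ C → C ∈ _ → ∃ λ D → D ∈ _ × map (f ∘ g) C ≈ D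
  maps-φ-∘ C C∈ with maps-φ G C C∈
  ... | D , D∈ , gC≈D with maps-φ F D D∈
  ... | D′ , D′∈ , fD≈D′ = D′ , D′∈ , ≈-trans (≡⇒≈ (map-∘ C)) (≈-trans (map-≈ f gC≈D) fD≈D′)

symmetry⇒quasiSymmetry : ∀ {σ : Lit n ↔ Lit n} → Symmetry P φ σ → QuasiSymmetry P φ (Inverse.to σ)
symmetry⇒quasiSymmetry {σ = σ} S = record
  { injective            = Injection.injective (↔⇒↣ σ)
  ; compl-commutes       = Admissible.respects-compl adm
  ; quant-preserved      = withinBlock-end ∘ block
  ; cross-block-monotone = λ k l → withinBlock-order (block k) (block l)
  ; maps-φ               = Symmetry.image⊆ S
  }
  where
  adm = Symmetry.admissible S
  block = admissible⇒withinBlock adm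

module _ (f-inj : Injective _≡_ _≡_ f) where

  map-resolvent : ∀ {u v} → Resolvent D₁ u D₂ v E →
                  Resolvent (map f D₁) (f u) (map f D₂) (f v) (map f E)
  map-resolvent {D₁ = D₁} {D₂ = D₂} {E = E} {u} {v} res l = forth , back
    where
    image : ∀ {D w k} → k ∈ D × k ≢ w → f k ∈ map f D × f k ≢ f w
    image (k∈ , k≢w) = ∈-map⁺ f k∈ , k≢w ∘ f-inj
    forth : l ∈ map f E → (l ∈ map f D₁ × l ≢ f u) ⊎ (l ∈ map f D₂ × l ≢ f v)
    forth l∈ with ∈-map⁻ f l∈
    ... | k , k∈ , refl = Sum.map image image (proj₁ (res k) k∈)
    back : (l ∈ map f D₁ × l ≢ f u) ⊎ (l ∈ map f D₂ × l ≢ f v) → l ∈ map f E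
    back (inj₁ (l∈ , l≢fu)) with ∈-map⁻ f l∈
    ... | k , k∈ , refl = ∈-map⁺ f (proj₂ (res k) (inj₁ (k∈ , l≢fu ∘ cong f)))
    back (inj₂ (l∈ , l≢fv)) with ∈-map⁻ f l∈
    ... | k , k∈ , refl = ∈-map⁺ f (proj₂ (res k) (inj₂ (k∈ , l≢fv ∘ cong f)))

  map-reduct : ∀ {u} → Reduct D u E → Reduct (map f D) (f u) (map f E)
  map-reduct {D = D} {E = E} {u} red l = forth , back
    where
    forth : l ∈ map f E → l ∈ map f D × l ≢ f u
    forth l∈ with ∈-map⁻ f l∈
    ... | k , k∈ , refl = ∈-map⁺ f (proj₁ (proj₁ (red k) k∈)) , proj₂ (proj₁ (red k) k∈) ∘ f-inj
    back : l ∈ map f D × l ≢ f u → l ∈ map f E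
    back (l∈ , l≢fu) with ∈-map⁻ f l∈
    ... | k , k∈ , refl = ∈-map⁺ f (proj₂ (red k) (k∈ , l≢fu ∘ cong f))

  map-nonTautology : (∀ l → f (compl l) ≡ compl (f l)) → ¬ Tautology E → ¬ Tautology (map f E)
  map-nonTautology {E = E} f-compl nt (x , p∈ , n∈) with ∈-map⁻ f p∈
  ... | k , k∈ , px≡fk =
    nt (complementary⇒tautology k∈
         (∈-map⁻-injective f-inj (subst (_∈ map f E) (trans (cong compl px≡fk) (sym (f-compl k))) n∈)))

map-existentialsBelow : ∀ {u} → QuasiSymmetry P φ f → IsUniv P u →
                        ExistentialsBelow P E u → ExistentialsBelow P (map f E) (f u)
map-existentialsBelow {P = P} {f = f} {u = u} F univ below l l∈ ex with ∈-map⁻ f l∈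
... | k , k∈ , refl =
  cross-block-monotone F k u (λ Pk≡Pu → ∃≢∀ (trans (sym exk) (trans Pk≡Pu univ))) (below k k∈ exk)
  where
  exk : IsExists P k
  exk = trans (sym (quant-preserved F k)) ex
  ∃≢∀ : ∃q ≢ ∀q
  ∃≢∀ ()

derivable-map : QuasiSymmetry P φ f → Derivable true P φ D → Derivable false P φ (map f D)
derivable-map {f = f} F (ruleA C∈ D≈C) with maps-φ F _ C∈
... | C′ , C′∈ , fC≈C′ = ruleA C′∈ (≈-trans (map-≈ f D≈C) fC≈C′)
derivable-map {f = f} F (ruleR x d₁ d₂ ex p∈ n∈ res nt) =
  resolve (f (pos x)) (derivable-map F d₁) (derivable-map F d₂)
    (trans (quant-preserved F (pos x)) ex)
    (∈-map⁺ f p∈)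
    (subst (_∈ _) (compl-commutes F (pos x)) (∈-map⁺ f n∈))
    (subst (λ v → Resolvent _ _ _ v _) (compl-commutes F (pos x)) (map-resolvent (injective F) res))
    (map-nonTautology (injective F) (compl-commutes F) nt)
derivable-map {f = f} F (ruleU {E = E} u d univ u∈ red ū∉ below) =
  ruleU (f u) (derivable-map F d) (trans (quant-preserved F u) univ) (∈-map⁺ f u∈)
    (map-reduct (injective F) red)
    (ū∉ ∘ ∈-map⁻-injective (injective F) ∘ subst (_∈ map f E) (sym (compl-commutes F u)))
    (map-existentialsBelow F univ below)
derivable-map {f = f} F (ruleS {D = C} σ _ d S D≈σC) =
  derivable-resp-≈ (≈-trans (map-≈ f D≈σC) (≡⇒≈ (sym (map-∘ C))))
    (derivable-map (quasiSymmetry-∘ F (symmetry⇒quasiSymmetry S)) d)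

mainTheorem3 : ∀ {n} (P : Prefix n) (φ : CNF n) (C : Clause n) →
    Derivable true P φ C → Derivable false P φ C
mainTheorem3 P φ C d = subst (Derivable false P φ) (map-id C) (derivable-map quasiSymmetry-id d)
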